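{- Let $(G,r)$ be a gadget and let $\mathbf{x}$ be a full vector spanning both $\ker A(G)_{(r)}$ and $\ker A(G^R)_{(r)}$. Then $\sum_{u\in G^+(r)}\mathbf{x}(u)=\sum_{u\in G^-(r)}\mathbf{x}(u)$.
   Context: A digraph $G$ is a finite nonempty vertex set $V(G)$ with an arbitrary binary relation $\to$; $G^+(v)=\{u:v\to u\}$, $G^-(v)=\{u:u\to v\}$. The adjacency matrix $A(G)$ (rows and columns indexed by $V(G)$) has entry $1$ in position $(v,u)$ iff $v\to u$, else $0$. The reverse digraph $G^R$ has the same vertices and $u\to_{G^R}v$ iff $v\to_G u$, so $A(G^R)=A(G)^\intercal$. For a matrix $M$ and a vertex $r$, $M_{(r)}$ is $M$ with the row indexed by $r$ deleted. A vector is full if it has no zero entry. A gadget is a pair $(G,r)$ with $r\in V(G)$ (the root) such that there is a full vector $\mathbf{x}\in\mathbb{R}^{V(G)}$ spanning both $\ker A(G)_{(r)}$ and $\ker A(G^R)_{(r)}$ (each being one-dimensional). -}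

module Defs where

open import Level using (Level; _⊔_; suc)
open import Data.Nat using (ℕ)
import Data.Fin as Fin
open Fin using (Fin)
open import Data.Bool using (Bool; true; false; if_then_else_)
open import Data.Product using (Σ; _×_; ∃)
open import Relation.Nullary using (¬_)
open import Relation.Binary.PropositionalEquality using (_≡_)
open import Algebra.Bundles using (CommutativeRing)

record Field (c ℓ : Level) : Set (Level.suc (c ⊔ ℓ)) where
  field
    commRing : CommutativeRing c ℓ
  open CommutativeRing commRing public hiding (ring)
  field
    0≉1     : ¬ (0# ≈ 1#)
    inverse : ∀ x → ¬ (x ≈ 0#) → ∃ λ y → x * y ≈ 1#

-- A (finite) digraph on vertex set Fin n: an arbitrary binary relation,
-- given by its characteristic function (v → u iff G v u ≡ true).
Digraph : ℕ → Set
Digraph n = Fin n → Fin n → Bool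

reverse : ∀ {n} → Digraph n → Digraph n
reverse G v u = G u v

module _ {c ℓ} (F : Field c ℓ) where
  open Field F

  Vector : ℕ → Set c
  Vector n = Fin n → Carrier

  Matrix : ℕ → Set c
  Matrix n = Fin n → Fin n → Carrier

  ∑ : ∀ {n} → (Fin n → Carrier) → Carrier
  ∑ {ℕ.zero}  f = 0#
  ∑ {ℕ.suc n} f = f Fin.zero + ∑ (λ i → f (Fin.suc i))

  adj : ∀ {n} → Digraph n → Matrix n
  adj G v u = if G v u then 1# else 0#

  _·_ : ∀ {n} → Matrix n → Vector n → Vector n
  (M · x) v = ∑ (λ u → M v u * x u)

  -- y ∈ ker M_(r), where M_(r) is M with the row indexed by r deleted.
  InKerDel : ∀ {n} → Matrix n → Fin n → Vector n → Set ℓ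
  InKerDel M r y = ∀ v → ¬ (v ≡ r) → (M · y) v ≈ 0#

  SpansKerDel : ∀ {n} → Matrix n → Fin n → Vector n → Set (c ⊔ ℓ)
  SpansKerDel M r x =
    ¬ (∀ i → x i ≈ 0#) ×
    InKerDel M r x ×
    (∀ y → InKerDel M r y → ∃ λ a → ∀ i → y i ≈ a * x i)

  Full : ∀ {n} → Vector n → Set ℓ
  Full x = ∀ i → ¬ (x i ≈ 0#)

  GadgetVector : ∀ {n} → Digraph n → Fin n → Vector n → Set (c ⊔ ℓ)
  GadgetVector G r x =
    Full x × SpansKerDel (adj G) r x × SpansKerDel (adj (reverse G)) r x

  IsGadget : ∀ {n} → Digraph n → Fin n → Set (c ⊔ ℓ)
  IsGadget G r = ∃ λ x → GadgetVector G r x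

  sumOut : ∀ {n} → Digraph n → Fin n → Vector n → Carrier
  sumOut G v x = ∑ (λ u → if G v u then x u else 0#)

  sumIn : ∀ {n} → Digraph n → Fin n → Vector n → Carrier
  sumIn G v x = ∑ (λ u → if G u v then x u else 0#)

{-# OPTIONS --safe #-}
-- For every square matrix M, xᵀ(M x) = xᵀ(Mᵀ x). When x is killed by M and
-- by Mᵀ outside the row r, both sums collapse to their r-th term, giving
-- x(r)·(M x)(r) = x(r)·(Mᵀ x)(r). For M = A(G) these r-th entries are the
-- out- and in-sums of x at r, and x(r) ≠ 0 cancels. Only x(r) ≠ 0 and the
-- two kernel memberships are used.
module Submission where

open import Data.Nat using (ℕ; zero; suc)
open import Data.Fin using (Fin; zero; suc)
open import Data.Fin.Properties using (punchInᵢ≢i)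
open import Data.Vec.Functional using (removeAt)
open import Data.Bool using (true; false; if_then_else_)
open import Data.Product using (_,_)
open import Algebra.Bundles using (CommutativeSemiring)
open import Relation.Nullary using (¬_)
open import Relation.Binary.PropositionalEquality as ≡ using (_≡_; _≢_)
import Relation.Binary.Reasoning.Setoid as SetoidReasoning
open import Defs

module _ {c ℓ} (R : CommutativeSemiring c ℓ) where
  open CommutativeSemiring R hiding (zero)
  open import Algebra.Properties.Semiring.Sum semiring
  open import Algebra.Solver.CommutativeMonoid *-commutativeMonoid using (solve; _⊕_; _⊜_)
  open SetoidReasoning setoid

  sum-concentrated : ∀ {n} (t : Fin n → Carrier) i →
    (∀ j → j ≢ i → t j ≈ 0#) → sum t ≈ t i
  sum-concentrated {suc n} t i t≈0 = begin
    sum t                      ≈⟨ sum-remove t ⟩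
    t i + sum (removeAt t i)   ≈⟨ +-congˡ rest≈0 ⟩
    t i + 0#                   ≈⟨ +-identityʳ (t i) ⟩
    t i                        ∎
    where
    rest≈0 : sum (removeAt t i) ≈ 0#
    rest≈0 = trans (sum-cong-≋ (λ j → t≈0 _ (punchInᵢ≢i i j))) (sum-replicate-zero n)

  ∑*∑-transpose : ∀ {n} (M : Fin n → Fin n → Carrier) (x : Fin n → Carrier) →
    ∑[ v < n ] (x v * ∑[ u < n ] (M v u * x u)) ≈ ∑[ v < n ] (x v * ∑[ u < n ] (M u v * x u))
  ∑*∑-transpose {n} M x = begin
    ∑[ v < n ] (x v * ∑[ u < n ] (M v u * x u))  ≈⟨ sum-cong-≋ (λ v → *-distribˡ-sum (x v) (λ u → M v u * x u)) ⟩
    ∑[ v < n ] ∑[ u < n ] (x v * (M v u * x u))  ≈⟨ ∑-comm (λ v u → x v * (M v u * x u)) ⟩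
    ∑[ u < n ] ∑[ v < n ] (x v * (M v u * x u))  ≈⟨ sum-cong-≋ (λ u → sum-cong-≋ (λ v → swap-ends (x v) _ (x u))) ⟩
    ∑[ u < n ] ∑[ v < n ] (x u * (M v u * x v))  ≈⟨ sum-cong-≋ (λ u → *-distribˡ-sum (x u) (λ v → M v u * x v)) ⟨
    ∑[ u < n ] (x u * ∑[ v < n ] (M v u * x v))  ∎
    where
    swap-ends : ∀ a m b → a * (m * b) ≈ b * (m * a)
    swap-ends = solve 3 (λ a m b → a ⊕ (m ⊕ b) ⊜ b ⊕ (m ⊕ a)) refl

  if-1#-0#-* : ∀ b y → (if b then 1# else 0#) * y ≈ (if b then y else 0#)
  if-1#-0#-* true  y = *-identityˡ y
  if-1#-0#-* false y = zeroˡ y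

module _ {c ℓ} (F : Field c ℓ) where
  open Field F hiding (zero)
  open import Algebra.Properties.Semiring.Sum semiring using (sum; sum-cong-≋)
  open SetoidReasoning setoid

  ∑≡sum : ∀ {n} (f : Fin n → Carrier) → ∑ F f ≡ sum f
  ∑≡sum {zero}  f = ≡.refl
  ∑≡sum {suc n} f = ≡.cong (f zero +_) (∑≡sum (λ i → f (suc i)))

  *-cancelˡ-≉0 : ∀ {z a b} → ¬ (z ≈ 0#) → z * a ≈ z * b → a ≈ b
  *-cancelˡ-≉0 {z} {a} {b} z≉0 za≈zb with inverse z z≉0
  ... | z⁻¹ , zz⁻¹≈1 = begin
    a                ≈⟨ *-identityˡ a ⟨
    1# * a           ≈⟨ *-congʳ z⁻¹z≈1 ⟨
    (z⁻¹ * z) * a    ≈⟨ *-assoc z⁻¹ z a ⟩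
    z⁻¹ * (z * a)    ≈⟨ *-congˡ za≈zb ⟩
    z⁻¹ * (z * b)    ≈⟨ *-assoc z⁻¹ z b ⟨
    (z⁻¹ * z) * b    ≈⟨ *-congʳ z⁻¹z≈1 ⟩
    1# * b           ≈⟨ *-identityˡ b ⟩
    b                ∎
    where
    z⁻¹z≈1 : z⁻¹ * z ≈ 1#
    z⁻¹z≈1 = trans (*-comm z⁻¹ z) zz⁻¹≈1

  adj·≈sumOut : ∀ {n} (G : Digraph n) v (x : Vector F n) → _·_ F (adj F G) x v ≈ sumOut F G v x
  adj·≈sumOut G v x = begin
    _·_ F (adj F G) x v                              ≡⟨ ∑≡sum (λ u → adj F G v u * x u) ⟩
    sum (λ u → adj F G v u * x u)                    ≈⟨ sum-cong-≋ (λ u → if-1#-0#-* commutativeSemiring (G v u) (x u)) ⟩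
    sum (λ u → if G v u then x u else 0#)            ≡⟨ ∑≡sum (λ u → if G v u then x u else 0#) ⟨
    sumOut F G v x                                   ∎

  quadratic-form : ∀ {n} → Matrix F n → Vector F n → Carrier
  quadratic-form M x = sum (λ v → x v * _·_ F M x v)

  _ᵀ : ∀ {n} → Matrix F n → Matrix F n
  (M ᵀ) v u = M u v

  quadratic-form-ᵀ : ∀ {n} (M : Matrix F n) (x : Vector F n) →
    quadratic-form M x ≈ quadratic-form (M ᵀ) x
  quadratic-form-ᵀ {n} M x = begin
    quadratic-form M x                          ≈⟨ inner-sums ⟩
    sum (λ v → x v * sum (λ u → M v u * x u))   ≈⟨ ∑*∑-transpose commutativeSemiring M x ⟩
    sum (λ v → x v * sum (λ u → M u v * x u))   ≈⟨ inner-sums ⟨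
    quadratic-form (M ᵀ) x                      ∎
    where
    inner-sums : ∀ {N : Matrix F n} → quadratic-form N x ≈ sum (λ v → x v * sum (λ u → N v u * x u))
    inner-sums {N} = sum-cong-≋ (λ v → *-congˡ (reflexive (∑≡sum (λ u → N v u * x u))))

  InKerDel⇒quadratic-form≈root : ∀ {n} {M : Matrix F n} {r} {x : Vector F n} →
    InKerDel F M r x → quadratic-form M x ≈ x r * _·_ F M x r
  InKerDel⇒quadratic-form≈root {r = r} x∈ker =
    sum-concentrated commutativeSemiring _ r (λ v v≢r → trans (*-congˡ (x∈ker v v≢r)) (zeroʳ _))

proposition32 : ∀ {c ℓ} (F : Field c ℓ) {n : ℕ} (G : Digraph n) (r : Fin n) →
    IsGadget F G r →
    (x : Vector F n) → GadgetVector F G r x →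
    Field._≈_ F (sumOut F G r x) (sumIn F G r x)
proposition32 F G r _ x (x-full , (_ , x∈kerA , _) , (_ , x∈kerAᵀ , _)) = begin
  sumOut F G r x                    ≈⟨ adj·≈sumOut F G r x ⟨
  _·_ F (adj F G) x r               ≈⟨ *-cancelˡ-≉0 F (x-full r) root-terms-agree ⟩
  _·_ F (adj F (reverse G)) x r     ≈⟨ adj·≈sumOut F (reverse G) r x ⟩
  sumIn F G r x                     ∎
  where
  open Field F hiding (zero)
  open SetoidReasoning setoid
  root-terms-agree : x r * _·_ F (adj F G) x r ≈ x r * _·_ F (adj F (reverse G)) x r
  root-terms-agree = begin
    x r * _·_ F (adj F G) x r                 ≈⟨ InKerDel⇒quadratic-form≈root F x∈kerA ⟨
    quadratic-form F (adj F G) x              ≈⟨ quadratic-form-ᵀ F (adj F G) x ⟩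
    quadratic-form F (adj F (reverse G)) x    ≈⟨ InKerDel⇒quadratic-form≈root F x∈kerAᵀ ⟩
    x r * _·_ F (adj F (reverse G)) x r       ∎
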